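{- Let $n,k,\lambda,\mu$ be integers. Suppose there exists a strongly regular graph with parameters $n,k,\lambda,\mu$. Define integers $c_0,c_1,c_2,\ldots$ by $c_0=n$, $c_1=0$, and for $\ell\ge 2$, \[ c_{\ell} \,=\, \mu n k^{\ell-2} + (\lambda-\mu)\, c_{\ell-1} + (k-\mu)\, c_{\ell-2}. \] Then every prime $p$ divides $c_p$.
   Context: A strongly regular graph with parameters $n,k,\lambda,\mu$ is a finite undirected graph $G$ (no loops or multiple edges) such that $G$ has $n$ vertices; $G$ is regular of degree $k$; every two adjacent vertices of $G$ have exactly $\lambda$ common neighbours; and every two distinct nonadjacent vertices of $G$ have exactly $\mu$ common neighbours. By convention, complete graphs and their complements are excluded, i.e. it is assumed that $0<k<n-1$. -}

module Defs where

open import Data.Nat using (ℕ; zero; suc; _<_; _∸_)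
open import Data.Bool using (Bool; true; false; _∧_)
open import Data.Fin using (Fin)
open import Data.List using (List; filter; length)
open import Data.List.Base using (allFin)
open import Data.Integer using (ℤ; +_; _+_; _-_; _*_; _^_)
open import Relation.Binary.PropositionalEquality using (_≡_; _≢_)
open import Relation.Nullary.Decidable using (Dec; yes; no)
open import Data.Bool.Properties using () renaming (_≟_ to _≟ᵇ_)
open import Data.Product using (_×_)

record Graph (n : ℕ) : Set where
  field
    adj   : Fin n → Fin n → Bool
    sym   : ∀ i j → adj i j ≡ adj j i
    irrefl : ∀ i → adj i i ≡ false
open Graph public

degree : ∀ {n} → Graph n → Fin n → ℕ
degree {n} G i = length (filter (λ j → adj G i j ≟ᵇ true) (allFin n))

common : ∀ {n} → Graph n → Fin n → Fin n → ℕ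
common {n} G i j = length (filter (λ v → (adj G i v ∧ adj G j v) ≟ᵇ true) (allFin n))

-- G is strongly regular with parameters (n, k, λ, μ); the vertex count n is
-- the index of the graph.  Complete graphs and their complements are excluded
-- via 0 < k < n - 1.
IsSRG : ∀ {n} → Graph n → (k λ' μ : ℕ) → Set
IsSRG {n} G k λ' μ =
    (0 < k) × (k < n ∸ 1)
  × (∀ i → degree G i ≡ k)
  × (∀ i j → i ≢ j → adj G i j ≡ true → common G i j ≡ λ')
  × (∀ i j → i ≢ j → adj G i j ≡ false → common G i j ≡ μ)

c : (n k λ' μ : ℤ) → ℕ → ℤ
c n k λ' μ zero = n
c n k λ' μ (suc zero) = + 0
c n k λ' μ (suc (suc ℓ)) =
  μ * n * (k ^ ℓ) + (λ' - μ) * c n k λ' μ (suc ℓ) + (k - μ) * c n k λ' μ ℓ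

module Submission where

-- Let A be the adjacency matrix of a strongly regular graph with parameters
-- (n, k, λ, μ).  Strong regularity says A² + μA + μI = λA + kI + μJ, and every
-- column of A sums to k, so J·A^ℓ = k^ℓ·J.  Multiplying the quadratic identity
-- by A^ℓ and taking traces shows that tr(A^ℓ) satisfies the recurrence that
-- defines c, with the same initial values tr(I) = n and tr(A) = 0 (no loops);
-- hence c_ℓ = tr(A^ℓ).
--
-- It remains to show p ∣ tr(A^p) for every prime p and every matrix A over ℕ
-- with zero diagonal.  tr(A^p) is the total weight of the closed walks of
-- length p; cyclic rotation acts on them with period p and preserves weights,
-- and its fixed points are constant walks, which have weight 0.  The necklace
-- lemma (non-trivial orbits of a map of prime period p have exactly p
-- elements) then gives the divisibility.

open import Defs using (Graph; IsSRG; degree; common; c)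

open import Data.Bool.Base using (Bool; true; false; _∧_)
open import Data.Bool.Properties using () renaming (_≟_ to _≟ᵇ_)
open import Data.Nat.Base
open import Data.Nat.Properties hiding (_≟_)
open import Data.Nat.Properties using () renaming (_≟_ to _≟ℕ_)
open import Data.Nat.Divisibility as ℕ using (_∣0; ∣m∣n⇒∣m+n; m∣m*n)
open import Data.Nat.Primality using (Prime; prime⇒nonZero)
open import Data.Nat.Coprimality using (prime⇒coprime; coprime-Bézout)
open import Data.Nat.GCD using (module Bézout)
open import Data.Nat.Tactic.RingSolver using (solve-∀)
open import Data.Fin.Base using (Fin; zero; suc; toℕ; inject₁; fromℕ)
open import Data.Fin.Properties using (toℕ-inject₁; toℕ-fromℕ; toℕ-injective; toℕ<n)
  renaming (suc-injective to Fin-suc-injective; 0≢1+n to zero≢suc; _≟_ to _≟ᶠ_)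
open import Data.List.Base
  using (List; []; _∷_; _++_; _∷ʳ_; [_]; length; map; concatMap; tabulate; allFin; filter)
open import Data.List.Properties using (≡-dec; length-++; ++-identityʳ; ++-assoc; ∷-injectiveˡ)
open import Data.List.Relation.Unary.All as All using (All; []; _∷_)
open import Data.List.Relation.Unary.All.Properties using (concat⁺; map⁺; tabulate⁺)
open import Data.Product.Base using (Σ; _×_; _,_; proj₁)
open import Data.Empty using (⊥-elim)
open import Relation.Nullary using (yes; no; does)
open import Relation.Binary.Definitions using (DecidableEquality; tri<; tri≈; tri>)
open import Relation.Binary.PropositionalEquality
  using (_≡_; _≢_; refl; sym; trans; cong; cong₂; subst; module ≡-Reasoning)
open import Algebra.Properties.CommutativeSemigroup +-commutativeSemigroup
  using () renaming (interchange to +-interchange)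
open import Algebra.Properties.Semiring.Sum +-*-semiring
  using (sum; sum-syntax; sum-cong-≗; ∑-comm; ∑-distrib-+; *-distribˡ-sum; *-distribʳ-sum;
         sum-init-last; sum-replicate-zero)

𝟙 : Bool → ℕ
𝟙 true  = 1
𝟙 false = 0

𝟙-∧ : ∀ a b → 𝟙 (a ∧ b) ≡ 𝟙 a * 𝟙 b
𝟙-∧ true  b = sym (+-identityʳ (𝟙 b))
𝟙-∧ false b = refl

𝟙≤1 : ∀ b → 𝟙 b ≤ 1
𝟙≤1 true  = ≤-refl
𝟙≤1 false = z≤n

module Delta {X : Set} (_≟_ : DecidableEquality X) where

  δ : X → X → ℕ
  δ x y = 𝟙 (does (x ≟ y))

  δ-refl : ∀ x → δ x x ≡ 1
  δ-refl x with x ≟ x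
  ... | yes _  = refl
  ... | no x≢x = ⊥-elim (x≢x refl)

  δ-≢ : ∀ {x y} → x ≢ y → δ x y ≡ 0
  δ-≢ {x} {y} x≢y with x ≟ y
  ... | yes x≡y = ⊥-elim (x≢y x≡y)
  ... | no _    = refl

  δ-pos : ∀ {x y} → 0 < δ x y → x ≡ y
  δ-pos {x} {y} pos with x ≟ y
  ... | yes x≡y = x≡y
  ... | no _    = ⊥-elim (<-irrefl refl pos)

  δ-subst : ∀ (f : X → ℕ) x y → δ x y * f x ≡ δ x y * f y
  δ-subst f x y with x ≟ y
  ... | yes refl = refl
  ... | no _     = refl

  δ-map : ∀ (f : X → X) {x y} → (f x ≡ f y → x ≡ y) → δ (f x) (f y) ≡ δ x y
  δ-map f {x} {y} inj with x ≟ y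
  ... | yes refl = δ-refl (f x)
  ... | no x≢y   = δ-≢ (λ fx≡fy → x≢y (inj fx≡fy))

∑-const : ∀ n x → ∑[ i < n ] x ≡ n * x
∑-const zero    x = refl
∑-const (suc n) x = cong (x +_) (∑-const n x)

∑-≤1 : ∀ {n} (f : Fin n → ℕ) → (∀ i → f i ≤ 1) →
       (∀ i j → 0 < f i → 0 < f j → i ≡ j) → ∑[ i < n ] f i ≤ 1
∑-≤1 {zero}  f f≤1 unique = z≤n
∑-≤1 {suc n} f f≤1 unique with f zero ≟ℕ 0
... | yes f₀≡0 = subst (λ z → z + ∑[ i < n ] f (suc i) ≤ 1) (sym f₀≡0)
      (∑-≤1 (λ i → f (suc i)) (λ i → f≤1 (suc i))
            (λ i j fi fj → Fin-suc-injective (unique (suc i) (suc j) fi fj)))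
... | no f₀≢0 = subst (_≤ 1) (sym (trans (cong (f zero +_) rest≡0) (+-identityʳ (f zero)))) (f≤1 zero)
  where
  rest≡0 : ∑[ i < n ] f (suc i) ≡ 0
  rest≡0 = trans (sum-cong-≗ {n} (λ i → n≤0⇒n≡0 (≮⇒≥ (λ fᵢ>0 →
                   zero≢suc (sym (unique (suc i) zero fᵢ>0 (n≢0⇒n>0 f₀≢0)))))))
                 (sum-replicate-zero n)

∑-rotate : ∀ p (g : ℕ → ℕ) → g p ≡ g 0 →
           ∑[ i < p ] g (suc (toℕ i)) ≡ ∑[ i < p ] g (toℕ i)
∑-rotate p g gp≡g0 = +-cancelʳ-≡ (g 0) _ _ (begin
  ∑[ i < p ] g (suc (toℕ i)) + g 0             ≡⟨ +-comm _ (g 0) ⟩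
  ∑[ i < suc p ] g (toℕ i)                     ≡⟨ sum-init-last (λ i → g (toℕ i)) ⟩
  ∑[ i < p ] g (toℕ (inject₁ i)) + g (toℕ (fromℕ p))
    ≡⟨ cong₂ _+_ (sum-cong-≗ {p} (λ i → cong g (toℕ-inject₁ i))) (trans (cong g (toℕ-fromℕ p)) gp≡g0) ⟩
  ∑[ i < p ] g (toℕ i) + g 0                   ∎)
  where open ≡-Reasoning

sumList : {X : Set} → List X → (X → ℕ) → ℕ
sumList []       f = 0
sumList (x ∷ xs) f = f x + sumList xs f

infixl 10 sumList
syntax sumList L (λ x → e) = ∑[ x ∈ L ] e

module _ {X : Set} where

  sumList-cong : ∀ (L : List X) {f g : X → ℕ} → (∀ x → f x ≡ g x) → ∑[ x ∈ L ] f x ≡ ∑[ x ∈ L ] g x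
  sumList-cong []       f≗g = refl
  sumList-cong (x ∷ xs) f≗g = cong₂ _+_ (f≗g x) (sumList-cong xs f≗g)

  sumList-distrib-+ : ∀ (L : List X) (f g : X → ℕ) →
                      ∑[ x ∈ L ] (f x + g x) ≡ ∑[ x ∈ L ] f x + ∑[ x ∈ L ] g x
  sumList-distrib-+ []       f g = refl
  sumList-distrib-+ (x ∷ xs) f g = begin
    (f x + g x) + ∑[ y ∈ xs ] (f y + g y)          ≡⟨ cong (f x + g x +_) (sumList-distrib-+ xs f g) ⟩
    (f x + g x) + (∑[ y ∈ xs ] f y + ∑[ y ∈ xs ] g y) ≡⟨ +-interchange (f x) (g x) _ _ ⟩
    (f x + ∑[ y ∈ xs ] f y) + (g x + ∑[ y ∈ xs ] g y) ∎
    where open ≡-Reasoning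

  sumList-*ˡ : ∀ (L : List X) c (f : X → ℕ) → ∑[ x ∈ L ] (c * f x) ≡ c * ∑[ x ∈ L ] f x
  sumList-*ˡ []       c f = sym (*-zeroʳ c)
  sumList-*ˡ (x ∷ xs) c f = trans (cong (c * f x +_) (sumList-*ˡ xs c f)) (sym (*-distribˡ-+ c (f x) _))

  sumList-*ʳ : ∀ (L : List X) c (f : X → ℕ) → ∑[ x ∈ L ] (f x * c) ≡ (∑[ x ∈ L ] f x) * c
  sumList-*ʳ L c f = trans (sumList-cong L (λ x → *-comm (f x) c))
                           (trans (sumList-*ˡ L c f) (*-comm c _))

  sumList-++ : ∀ (L M : List X) (f : X → ℕ) → ∑[ x ∈ L ++ M ] f x ≡ ∑[ x ∈ L ] f x + ∑[ x ∈ M ] f x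
  sumList-++ []       M f = refl
  sumList-++ (x ∷ xs) M f = trans (cong (f x +_) (sumList-++ xs M f)) (sym (+-assoc (f x) _ _))

  sumList-∑ : ∀ (L : List X) m (F : X → Fin m → ℕ) →
              ∑[ x ∈ L ] ∑[ i < m ] F x i ≡ ∑[ i < m ] ∑[ x ∈ L ] F x i
  sumList-∑ []       m F = sym (sum-replicate-zero m)
  sumList-∑ (x ∷ xs) m F = trans (cong (∑[ i < m ] F x i +_) (sumList-∑ xs m F))
                                 (sym (∑-distrib-+ (F x) (λ i → ∑[ y ∈ xs ] F y i)))

  sumList-map : ∀ {Y : Set} (h : Y → X) (L : List Y) (f : X → ℕ) →
                ∑[ x ∈ map h L ] f x ≡ ∑[ y ∈ L ] f (h y)
  sumList-map h []       f = refl
  sumList-map h (y ∷ ys) f = cong (f (h y) +_) (sumList-map h ys f)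

  sumList-concatMap : ∀ {Y : Set} (F : Y → List X) (L : List Y) (f : X → ℕ) →
                      ∑[ x ∈ concatMap F L ] f x ≡ ∑[ y ∈ L ] ∑[ x ∈ F y ] f x
  sumList-concatMap F []       f = refl
  sumList-concatMap F (y ∷ ys) f = trans (sumList-++ (F y) (concatMap F ys) f)
                                         (cong (∑[ x ∈ F y ] f x +_) (sumList-concatMap F ys f))

  sumList-tabulate : ∀ {n} (h : Fin n → X) (f : X → ℕ) → ∑[ x ∈ tabulate h ] f x ≡ ∑[ i < n ] f (h i)
  sumList-tabulate {zero}  h f = refl
  sumList-tabulate {suc n} h f = cong (f (h zero) +_) (sumList-tabulate (λ i → h (suc i)) f)

  sumList-pos : ∀ {P : X → Set} (L : List X) (f : X → ℕ) → All P L →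
                0 < ∑[ x ∈ L ] f x → Σ X (λ x → P x × 0 < f x)
  sumList-pos (x ∷ xs) f (px ∷ pxs) pos with f x ≟ℕ 0
  ... | yes fx≡0 = sumList-pos xs f pxs (subst (λ z → 0 < z + ∑[ y ∈ xs ] f y) fx≡0 pos)
  ... | no fx≢0  = x , px , n≢0⇒n>0 fx≢0

_^[_]_ : {X : Set} → (X → X) → ℕ → X → X
σ ^[ zero ]  x = x
σ ^[ suc m ] x = σ (σ ^[ m ] x)

module _ {X : Set} (σ : X → X) where

  iter-+ : ∀ a b x → σ ^[ a + b ] x ≡ σ ^[ a ] (σ ^[ b ] x)
  iter-+ zero    b x = refl
  iter-+ (suc a) b x = cong σ (iter-+ a b x)

  iter-suc : ∀ m x → σ ^[ suc m ] x ≡ σ ^[ m ] (σ x)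
  iter-suc zero    x = refl
  iter-suc (suc m) x = cong σ (iter-suc m x)

  iter-absorb : ∀ a {x} → σ ^[ a ] x ≡ x → ∀ b → σ ^[ b + a ] x ≡ σ ^[ b ] x
  iter-absorb a {x} per b = trans (iter-+ b a x) (cong (σ ^[ b ]_) per)

  iter-multiple : ∀ a {x} → σ ^[ a ] x ≡ x → ∀ k → σ ^[ k * a ] x ≡ x
  iter-multiple a per zero    = refl
  iter-multiple a per (suc k) = trans (iter-absorb (k * a) (iter-multiple a per k) a) per

  -- If x has prime period p and also a period d with 0 < d < p, then x is
  -- fixed: by Bézout, 1 is an integer combination of d and p.
  prime-period : ∀ {p d x} → Prime p → σ ^[ p ] x ≡ x →
                 0 < d → d < p → σ ^[ d ] x ≡ x → σ x ≡ x
  prime-period {p} {d} {x} p-prime per-p d>0 d<p per-d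
    with coprime-Bézout (prime⇒coprime p-prime {{>-nonZero d>0}} d<p)
  ... | Bézout.+- u v 1+vd≡up = begin
    σ ^[ 1 ] x         ≡⟨ iter-absorb (v * d) (iter-multiple d per-d v) 1 ⟨
    σ ^[ 1 + v * d ] x ≡⟨ cong (λ m → σ ^[ m ] x) 1+vd≡up ⟩
    σ ^[ u * p ] x     ≡⟨ iter-multiple p per-p u ⟩
    x                  ∎
    where open ≡-Reasoning
  ... | Bézout.-+ u v 1+up≡vd = begin
    σ ^[ 1 ] x         ≡⟨ iter-absorb (u * p) (iter-multiple p per-p u) 1 ⟨
    σ ^[ 1 + u * p ] x ≡⟨ cong (λ m → σ ^[ m ] x) 1+up≡vd ⟩
    σ ^[ v * d ] x     ≡⟨ iter-multiple d per-d v ⟩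
    x                  ∎
    where open ≡-Reasoning

  -- The first p iterates of a non-fixed point of prime period p are
  -- distinct: a repetition σ^i x = σ^j x yields the period p - j + i.
  iterates-distinct : ∀ {p x i j} → Prime p → σ ^[ p ] x ≡ x → σ x ≢ x →
                      i < j → j < p → σ ^[ i ] x ≢ σ ^[ j ] x
  iterates-distinct {p} {x} {i} {j} p-prime per-p not-fixed i<j j<p σⁱx≡σʲx =
    not-fixed (prime-period p-prime per-p (<-≤-trans (m<n⇒0<n∸m j<p) (m≤m+n (p ∸ j) i)) d<p per-d)
    where
    d<p : p ∸ j + i < p
    d<p = begin-strict
      p ∸ j + i <⟨ +-monoʳ-< (p ∸ j) i<j ⟩
      p ∸ j + j ≡⟨ m∸n+n≡m (<⇒≤ j<p) ⟩
      p         ∎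
      where open ≤-Reasoning
    per-d : σ ^[ p ∸ j + i ] x ≡ x
    per-d = begin
      σ ^[ p ∸ j + i ] x         ≡⟨ iter-+ (p ∸ j) i x ⟩
      σ ^[ p ∸ j ] (σ ^[ i ] x)  ≡⟨ cong (σ ^[ p ∸ j ]_) σⁱx≡σʲx ⟩
      σ ^[ p ∸ j ] (σ ^[ j ] x)  ≡⟨ iter-+ (p ∸ j) j x ⟨
      σ ^[ p ∸ j + j ] x         ≡⟨ cong (λ m → σ ^[ m ] x) (m∸n+n≡m (<⇒≤ j<p)) ⟩
      σ ^[ p ] x                 ≡⟨ per-p ⟩
      x                          ∎
      where open ≡-Reasoning

split-≤1 : ∀ {o} → o ≤ 1 → ∀ m → m ≡ (1 ∸ o) * m + o * m
split-≤1 {zero}     _ m = sym (trans (+-identityʳ (1 * m)) (*-identityˡ m))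
split-≤1 {suc zero} _ m = sym (+-identityʳ m)
split-≤1 {suc (suc _)} (s≤s ())

-- Let σ act on a set D with σ^p = id for a prime p,
-- and let the list L enumerate D, each element exactly once.  Every
-- σ-invariant weight f on D that vanishes on the fixed points of σ has
-- total weight divisible by p: the non-trivial orbits have exactly p
-- elements, and f is constant on each of them.  The proof removes one
-- orbit at a time, by induction on the total weight.
module Necklace {X : Set} (_≟_ : DecidableEquality X) (σ : X → X)
                {p : ℕ} (p-prime : Prime p)
                (D : X → Set) (D-σ : ∀ {x} → D x → D (σ x))
                (D-periodic : ∀ {x} → D x → σ ^[ p ] x ≡ x)
                (L : List X) (L⊆D : All D L)
                (L-enumerates : ∀ {y} → D y → ∑[ w ∈ L ] Delta.δ _≟_ w y ≡ 1) where

  open Delta _≟_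

  p>0 : 0 < p
  p>0 = >-nonZero⁻¹ p {{prime⇒nonZero p-prime}}

  D-iter : ∀ m {x} → D x → D (σ ^[ m ] x)
  D-iter zero    Dx = Dx
  D-iter (suc m) Dx = D-σ (D-iter m Dx)

  -- σ is injective on D, with inverse σ^(p-1).
  σ-injective : ∀ {x y} → D x → D y → σ x ≡ σ y → x ≡ y
  σ-injective {x} {y} Dx Dy σx≡σy = begin
    x                      ≡⟨ σ-inverse Dx ⟨
    σ ^[ p ∸ 1 ] (σ x)     ≡⟨ cong (σ ^[ p ∸ 1 ]_) σx≡σy ⟩
    σ ^[ p ∸ 1 ] (σ y)     ≡⟨ σ-inverse Dy ⟩
    y                      ∎
    where
    open ≡-Reasoning
    σ-inverse : ∀ {z} → D z → σ ^[ p ∸ 1 ] (σ z) ≡ z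
    σ-inverse {z} Dz = trans (sym (iter-+ σ (p ∸ 1) 1 z))
                             (trans (cong (λ m → σ ^[ m ] z) (m∸n+n≡m p>0)) (D-periodic Dz))

  inOrbit : X → X → ℕ
  inOrbit x w = ∑[ i < p ] δ w (σ ^[ toℕ i ] x)

  inOrbit≤1 : ∀ {x} → D x → σ x ≢ x → ∀ w → inOrbit x w ≤ 1
  inOrbit≤1 {x} Dx not-fixed w = ∑-≤1 _ (λ i → 𝟙≤1 _) unique
    where
    distinct : ∀ {i j : Fin p} → toℕ i < toℕ j → σ ^[ toℕ i ] x ≢ σ ^[ toℕ j ] x
    distinct {j = j} i<j = iterates-distinct σ p-prime (D-periodic Dx) not-fixed i<j (toℕ<n j)
    unique : ∀ i j → 0 < δ w (σ ^[ toℕ i ] x) → 0 < δ w (σ ^[ toℕ j ] x) → i ≡ j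
    unique i j wᵢ wⱼ with <-cmp (toℕ i) (toℕ j)
    ... | tri< i<j _ _ = ⊥-elim (distinct i<j (trans (sym (δ-pos wᵢ)) (δ-pos wⱼ)))
    ... | tri≈ _ i≡j _ = toℕ-injective i≡j
    ... | tri> _ _ j<i = ⊥-elim (distinct j<i (trans (sym (δ-pos wⱼ)) (δ-pos wᵢ)))

  inOrbit-total : ∀ {x} → D x → ∑[ w ∈ L ] inOrbit x w ≡ p
  inOrbit-total {x} Dx = begin
    ∑[ w ∈ L ] ∑[ i < p ] δ w (σ ^[ toℕ i ] x) ≡⟨ sumList-∑ L p _ ⟩
    ∑[ i < p ] ∑[ w ∈ L ] δ w (σ ^[ toℕ i ] x) ≡⟨ sum-cong-≗ {p} (λ i → L-enumerates (D-iter (toℕ i) Dx)) ⟩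
    ∑[ i < p ] 1                               ≡⟨ ∑-const p 1 ⟩
    p * 1                                      ≡⟨ *-identityʳ p ⟩
    p                                          ∎
    where open ≡-Reasoning

  inOrbit-σ : ∀ {x w} → D x → D w → inOrbit x (σ w) ≡ inOrbit x w
  inOrbit-σ {x} {w} Dx Dw = begin
    ∑[ i < p ] δ (σ w) (σ ^[ toℕ i ] x)
      ≡⟨ ∑-rotate p (λ m → δ (σ w) (σ ^[ m ] x)) (cong (δ (σ w)) (D-periodic Dx)) ⟨
    ∑[ i < p ] δ (σ w) (σ (σ ^[ toℕ i ] x))
      ≡⟨ sum-cong-≗ {p} (λ i → δ-map σ (σ-injective Dw (D-iter (toℕ i) Dx))) ⟩
    ∑[ i < p ] δ w (σ ^[ toℕ i ] x)         ∎
    where open ≡-Reasoning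

  record Admissible (f : X → ℕ) : Set where
    field
      invariant : ∀ {x} → D x → f (σ x) ≡ f x
      vanishes  : ∀ {x} → D x → σ x ≡ x → f x ≡ 0

    invariant-iter : ∀ m {x} → D x → f (σ ^[ m ] x) ≡ f x
    invariant-iter zero    Dx = refl
    invariant-iter (suc m) Dx = trans (invariant (D-iter m Dx)) (invariant-iter m Dx)

    inOrbit-weight : ∀ {x} → D x → ∀ w → inOrbit x w * f w ≡ inOrbit x w * f x
    inOrbit-weight {x} Dx w = begin
      inOrbit x w * f w                                ≡⟨ *-distribʳ-sum {p} (f w) _ ⟩
      ∑[ i < p ] (δ w (σ ^[ toℕ i ] x) * f w)          ≡⟨ sum-cong-≗ {p} (λ i → δ-subst f w _) ⟩
      ∑[ i < p ] (δ w (σ ^[ toℕ i ] x) * f (σ ^[ toℕ i ] x))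
        ≡⟨ sum-cong-≗ {p} (λ i → cong (δ w (σ ^[ toℕ i ] x) *_) (invariant-iter (toℕ i) Dx)) ⟩
      ∑[ i < p ] (δ w (σ ^[ toℕ i ] x) * f x)          ≡⟨ *-distribʳ-sum {p} (f x) _ ⟨
      inOrbit x w * f x                                ∎
      where open ≡-Reasoning

  open Admissible

  module RemoveOrbit {f} (adm : Admissible f) {x} (Dx : D x) (fx>0 : 0 < f x) where

    not-fixed : σ x ≢ x
    not-fixed σx≡x = <-irrefl (sym (vanishes adm Dx σx≡x)) fx>0

    -- The weight with the orbit of x removed.
    f′ : X → ℕ
    f′ w = (1 ∸ inOrbit x w) * f w

    split : ∀ w → f w ≡ f′ w + inOrbit x w * f x
    split w = trans (split-≤1 (inOrbit≤1 Dx not-fixed w) (f w))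
                    (cong (f′ w +_) (inOrbit-weight adm Dx w))

    total-split : ∑[ w ∈ L ] f w ≡ ∑[ w ∈ L ] f′ w + p * f x
    total-split = begin
      ∑[ w ∈ L ] f w                                          ≡⟨ sumList-cong L split ⟩
      ∑[ w ∈ L ] (f′ w + inOrbit x w * f x)                   ≡⟨ sumList-distrib-+ L f′ _ ⟩
      ∑[ w ∈ L ] f′ w + ∑[ w ∈ L ] (inOrbit x w * f x)
        ≡⟨ cong (∑[ w ∈ L ] f′ w +_) (sumList-*ʳ L (f x) (inOrbit x)) ⟩
      ∑[ w ∈ L ] f′ w + (∑[ w ∈ L ] inOrbit x w) * f x
        ≡⟨ cong (λ m → ∑[ w ∈ L ] f′ w + m * f x) (inOrbit-total Dx) ⟩
      ∑[ w ∈ L ] f′ w + p * f x                               ∎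
      where open ≡-Reasoning

    f′-admissible : Admissible f′
    f′-admissible .invariant Dw = cong₂ (λ o m → (1 ∸ o) * m) (inOrbit-σ Dx Dw) (invariant adm Dw)
    f′-admissible .vanishes {w} Dw σw≡w =
      trans (cong ((1 ∸ inOrbit x w) *_) (vanishes adm Dw σw≡w)) (*-zeroʳ (1 ∸ inOrbit x w))

  necklace-bounded : ∀ N {f} → Admissible f → ∑[ w ∈ L ] f w ≤ N → p ℕ.∣ ∑[ w ∈ L ] f w
  necklace-bounded zero    adm total≤0 = subst (p ℕ.∣_) (sym (n≤0⇒n≡0 total≤0)) (p ∣0)
  necklace-bounded (suc N) {f} adm total≤N with ∑[ w ∈ L ] f w ≟ℕ 0
  ... | yes total≡0 = subst (p ℕ.∣_) (sym total≡0) (p ∣0)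
  ... | no total≢0 with sumList-pos L f L⊆D (n≢0⇒n>0 total≢0)
  ...   | x , Dx , fx>0 = subst (p ℕ.∣_) (sym total-split) (∣m∣n⇒∣m+n rest (m∣m*n (f x)))
    where
    open RemoveOrbit adm Dx fx>0
    rest : p ℕ.∣ ∑[ w ∈ L ] f′ w
    rest = necklace-bounded N f′-admissible (s≤s⁻¹ (begin-strict
      ∑[ w ∈ L ] f′ w           <⟨ m<m+n _ (*-mono-< p>0 fx>0) ⟩
      ∑[ w ∈ L ] f′ w + p * f x ≡⟨ total-split ⟨
      ∑[ w ∈ L ] f w            ≤⟨ total≤N ⟩
      suc N                     ∎))
      where open ≤-Reasoning

  necklace : ∀ {f} → Admissible f → p ℕ.∣ ∑[ w ∈ L ] f w
  necklace adm = necklace-bounded _ adm ≤-refl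

Matrix : ℕ → Set
Matrix n = Fin n → Fin n → ℕ

module FinDelta {n : ℕ} = Delta (_≟ᶠ_ {n})
open FinDelta using (δ; δ-refl)

∑-δˡ : ∀ {n} (f : Fin n → ℕ) i → ∑[ j < n ] (δ j i * f j) ≡ f i
∑-δˡ {suc n} f zero    = trans (cong (_+ _) (+-identityʳ (f zero)))
                               (trans (cong (f zero +_) (sum-replicate-zero n)) (+-identityʳ (f zero)))
∑-δˡ {suc n} f (suc i) = ∑-δˡ (λ j → f (suc j)) i

∑-δʳ : ∀ {n} (f : Fin n → ℕ) i → ∑[ j < n ] (δ i j * f j) ≡ f i
∑-δʳ {suc n} f zero    = trans (cong (_+ _) (+-identityʳ (f zero)))
                               (trans (cong (f zero +_) (sum-replicate-zero n)) (+-identityʳ (f zero)))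
∑-δʳ {suc n} f (suc i) = ∑-δʳ (λ j → f (suc j)) i

module _ {n : ℕ} where

  infixl 7 _∙_
  _∙_ : Matrix n → Matrix n → Matrix n
  (M ∙ N) i j = ∑[ v < n ] (M i v * N v j)

  power : Matrix n → ℕ → Matrix n
  power A zero    = δ
  power A (suc m) = A ∙ power A m

  trace : Matrix n → ℕ
  trace M = ∑[ i < n ] M i i

∑-linear : ∀ {n} (f g h : Fin n → ℕ) b c →
           ∑[ i < n ] (f i + b * g i + c * h i) ≡ ∑[ i < n ] f i + b * ∑[ i < n ] g i + c * ∑[ i < n ] h i
∑-linear {n} f g h b c = begin
  ∑[ i < n ] (f i + b * g i + c * h i)                        ≡⟨ ∑-distrib-+ (λ i → f i + b * g i) (λ i → c * h i) ⟩
  ∑[ i < n ] (f i + b * g i) + ∑[ i < n ] (c * h i)           ≡⟨ cong (_+ _) (∑-distrib-+ f (λ i → b * g i)) ⟩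
  ∑[ i < n ] f i + ∑[ i < n ] (b * g i) + ∑[ i < n ] (c * h i)
    ≡⟨ cong₂ (λ s t → ∑[ i < n ] f i + s + t) (*-distribˡ-sum b g) (*-distribˡ-sum c h) ⟨
  ∑[ i < n ] f i + b * ∑[ i < n ] g i + c * ∑[ i < n ] h i    ∎
  where open ≡-Reasoning

∙-assoc : ∀ {n} (M N P : Matrix n) i j → (M ∙ (N ∙ P)) i j ≡ ((M ∙ N) ∙ P) i j
∙-assoc {n} M N P i j = begin
  ∑[ v < n ] (M i v * ∑[ u < n ] (N v u * P u j))
    ≡⟨ sum-cong-≗ {n} (λ v → *-distribˡ-sum (M i v) (λ u → N v u * P u j)) ⟩
  ∑[ v < n ] ∑[ u < n ] (M i v * (N v u * P u j))   ≡⟨ ∑-comm (λ v u → M i v * (N v u * P u j)) ⟩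
  ∑[ u < n ] ∑[ v < n ] (M i v * (N v u * P u j))
    ≡⟨ sum-cong-≗ {n} (λ u → sum-cong-≗ {n} (λ v → *-assoc (M i v) (N v u) (P u j))) ⟨
  ∑[ u < n ] ∑[ v < n ] (M i v * N v u * P u j)
    ≡⟨ sum-cong-≗ {n} (λ u → *-distribʳ-sum (P u j) (λ v → M i v * N v u)) ⟨
  ∑[ u < n ] (∑[ v < n ] (M i v * N v u) * P u j)   ∎
  where open ≡-Reasoning

trace-δ : ∀ {n} → trace {n} δ ≡ n
trace-δ {n} = trans (sum-cong-≗ {n} δ-refl) (trans (∑-const n 1) (*-identityʳ n))

trace-zero-diagonal : ∀ {n} (A : Matrix n) → (∀ i → A i i ≡ 0) → trace (power A 1) ≡ 0
trace-zero-diagonal {n} A zero-diagonal = trans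
  (sum-cong-≗ {n} (λ i → trans (sum-cong-≗ {n} (λ v → *-comm (A i v) (δ v i)))
                               (trans (∑-δˡ (A i) i) (zero-diagonal i))))
  (sum-replicate-zero n)

rotate : {X : Set} → List X → List X
rotate []       = []
rotate (x ∷ xs) = xs ∷ʳ x

module _ {X : Set} where

  length-rotate : ∀ (w : List X) → length (rotate w) ≡ length w
  length-rotate []       = refl
  length-rotate (x ∷ xs) = trans (length-++ xs) (+-comm (length xs) 1)

  rotate-++ : ∀ (xs ys : List X) → rotate ^[ length xs ] (xs ++ ys) ≡ ys ++ xs
  rotate-++ []       ys = sym (++-identityʳ ys)
  rotate-++ (x ∷ xs) ys = begin
    rotate ^[ suc (length xs) ] (x ∷ xs ++ ys) ≡⟨ iter-suc rotate (length xs) _ ⟩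
    rotate ^[ length xs ] ((xs ++ ys) ∷ʳ x)   ≡⟨ cong (rotate ^[ length xs ]_) (++-assoc xs ys [ x ]) ⟩
    rotate ^[ length xs ] (xs ++ (ys ∷ʳ x))   ≡⟨ rotate-++ xs (ys ∷ʳ x) ⟩
    (ys ∷ʳ x) ++ xs                           ≡⟨ ++-assoc ys [ x ] xs ⟩
    ys ++ x ∷ xs                              ∎
    where open ≡-Reasoning

  rotate-periodic : ∀ (w : List X) → rotate ^[ length w ] w ≡ w
  rotate-periodic w = trans (cong (rotate ^[ length w ]_) (sym (++-identityʳ w))) (rotate-++ w [])

module ClosedWalks {n : ℕ} (A : Matrix n) where

  Word : Set
  Word = List (Fin n)

  _≟ʷ_ : DecidableEquality Word
  _≟ʷ_ = ≡-dec _≟ᶠ_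

  open Delta _≟ʷ_ using () renaming (δ to δʷ)

  words : ℕ → List Word
  words zero    = [ [] ]
  words (suc m) = concatMap (λ v → map (v ∷_) (words m)) (allFin n)

  sum-words : ∀ m (F : Word → ℕ) →
              ∑[ w ∈ words (suc m) ] F w ≡ ∑[ v < n ] ∑[ ws ∈ words m ] F (v ∷ ws)
  sum-words m F = begin
    ∑[ w ∈ words (suc m) ] F w                           ≡⟨ sumList-concatMap _ (allFin n) F ⟩
    ∑[ v ∈ allFin n ] ∑[ w ∈ map (v ∷_) (words m) ] F w  ≡⟨ sumList-tabulate {n = n} (λ v → v) _ ⟩
    ∑[ v < n ] ∑[ w ∈ map (v ∷_) (words m) ] F w         ≡⟨ sum-cong-≗ {n} (λ v → sumList-map (v ∷_) (words m) F) ⟩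
    ∑[ v < n ] ∑[ ws ∈ words m ] F (v ∷ ws)              ∎
    where open ≡-Reasoning

  words-length : ∀ m → All (λ w → length w ≡ m) (words m)
  words-length zero    = refl ∷ []
  words-length (suc m) = concat⁺ (map⁺ (tabulate⁺ {f = λ v → v} extend))
    where
    extend : ∀ v → All (λ w → length w ≡ suc m) (map (v ∷_) (words m))
    extend v = map⁺ (All.map (cong suc) (words-length m))

  words-enumerate : ∀ m {y} → length y ≡ m → ∑[ w ∈ words m ] δʷ w y ≡ 1
  words-enumerate zero    {[]}     _   = refl
  words-enumerate (suc m) {u ∷ ys} len = begin
    ∑[ w ∈ words (suc m) ] δʷ w (u ∷ ys)                 ≡⟨ sum-words m _ ⟩
    ∑[ v < n ] ∑[ ws ∈ words m ] δʷ (v ∷ ws) (u ∷ ys)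
      ≡⟨ sum-cong-≗ {n} (λ v → sumList-cong (words m) (λ ws → 𝟙-∧ (does (v ≟ᶠ u)) (does (ws ≟ʷ ys)))) ⟩
    ∑[ v < n ] ∑[ ws ∈ words m ] (δ v u * δʷ ws ys)      ≡⟨ sum-cong-≗ {n} (λ v → sumList-*ˡ (words m) (δ v u) _) ⟩
    ∑[ v < n ] (δ v u * ∑[ ws ∈ words m ] δʷ ws ys)
      ≡⟨ sum-cong-≗ {n} (λ v → cong (δ v u *_) (words-enumerate m (suc-injective len))) ⟩
    ∑[ v < n ] (δ v u * 1)                               ≡⟨ ∑-δˡ (λ _ → 1) u ⟩
    1                                                    ∎
    where open ≡-Reasoning

  -- Weight of the walk u → y₁ → … → yᵣ → e.
  walk : Fin n → Word → Fin n → ℕ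
  walk u []       e = A u e
  walk u (y ∷ ys) e = A u y * walk y ys e

  walk-∷ʳ : ∀ u ys x e → walk u (ys ∷ʳ x) e ≡ walk u ys x * A x e
  walk-∷ʳ u []       x e = refl
  walk-∷ʳ u (y ∷ ys) x e = trans (cong (A u y *_) (walk-∷ʳ y ys x e)) (sym (*-assoc (A u y) _ _))

  closedWalk : Word → ℕ
  closedWalk []       = 0
  closedWalk (x ∷ xs) = walk x xs x

  closedWalk-rotate : ∀ w → closedWalk (rotate w) ≡ closedWalk w
  closedWalk-rotate []           = refl
  closedWalk-rotate (x ∷ [])     = refl
  closedWalk-rotate (x ∷ y ∷ ys) = trans (walk-∷ʳ y ys x y) (*-comm _ (A x y))

  -- A closed walk fixed by rotation is constant, so it uses a diagonal entry.
  closedWalk-fixed : (∀ i → A i i ≡ 0) → ∀ w → rotate w ≡ w → closedWalk w ≡ 0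
  closedWalk-fixed zero-diag []           _   = refl
  closedWalk-fixed zero-diag (x ∷ [])     _   = zero-diag x
  closedWalk-fixed zero-diag (x ∷ y ∷ ys) rot≡ = begin
    A x y * walk y ys x ≡⟨ cong (λ z → A x z * walk y ys x) (∷-injectiveˡ rot≡) ⟩
    A x x * walk y ys x ≡⟨ cong (_* walk y ys x) (zero-diag x) ⟩
    0                   ∎
    where open ≡-Reasoning

  power-walks : ∀ m i j → power A (suc m) i j ≡ ∑[ ws ∈ words m ] walk i ws j
  power-walks zero    i j = trans (sum-cong-≗ {n} (λ v → *-comm (A i v) (δ v j)))
                                  (trans (∑-δˡ (A i) j) (sym (+-identityʳ (A i j))))
  power-walks (suc m) i j = begin
    ∑[ v < n ] (A i v * power A (suc m) v j)              ≡⟨ sum-cong-≗ {n} (λ v → cong (A i v *_) (power-walks m v j)) ⟩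
    ∑[ v < n ] (A i v * ∑[ ws ∈ words m ] walk v ws j)    ≡⟨ sum-cong-≗ {n} (λ v → sumList-*ˡ (words m) (A i v) _) ⟨
    ∑[ v < n ] ∑[ ws ∈ words m ] (A i v * walk v ws j)    ≡⟨ sum-words m (λ ws → walk i ws j) ⟨
    ∑[ ws ∈ words (suc m) ] walk i ws j                   ∎
    where open ≡-Reasoning

  trace-closedWalks : ∀ m → trace (power A (suc m)) ≡ ∑[ w ∈ words (suc m) ] closedWalk w
  trace-closedWalks m = trans (sum-cong-≗ {n} (λ i → power-walks m i i)) (sym (sum-words m closedWalk))

-- For a matrix with zero diagonal, p divides trace (A^p) for every prime p:
-- apply the necklace lemma to rotation of closed walks of length p.
trace-power-prime : ∀ {n} (A : Matrix n) → (∀ i → A i i ≡ 0) →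
                    ∀ {p} → Prime p → p ℕ.∣ trace (power A p)
trace-power-prime A zero-diag {zero} p-prime = ⊥-elim (≢-nonZero⁻¹ 0 {{prime⇒nonZero p-prime}} refl)
trace-power-prime A zero-diag {suc m} p-prime =
  subst (suc m ℕ.∣_) (sym (trace-closedWalks m)) (necklace closedWalk-admissible)
  where
  open ClosedWalks A
  open Necklace _≟ʷ_ rotate p-prime (λ w → length w ≡ suc m)
                (λ {w} len → trans (length-rotate w) len)
                (λ {w} len → subst (λ l → rotate ^[ l ] w ≡ w) len (rotate-periodic w))
                (words (suc m)) (words-length (suc m)) (words-enumerate (suc m))
  closedWalk-admissible : Admissible closedWalk
  closedWalk-admissible = record
    { invariant = λ {w} _ → closedWalk-rotate w
    ; vanishes  = λ {w} _ → closedWalk-fixed zero-diag w }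

factor-right : ∀ x a d w m → x * w + m * (a * w) + m * (d * w) ≡ (x + m * a + m * d) * w
factor-right = solve-∀

expand-right : ∀ l a k d m w → (l * a + k * d + m) * w ≡ l * (a * w) + k * (d * w) + m * w
expand-right = solve-∀

bring-to-front : ∀ s t m n e → s + t + m * (n * e) ≡ m * n * e + s + t
bring-to-front = solve-∀

module TraceRecurrence {n : ℕ} (A : Matrix n) (k λ' μ : ℕ)
  (column-sum : ∀ j → ∑[ i < n ] A i j ≡ k)
  (quadratic : ∀ i j → (A ∙ A) i j + μ * A i j + μ * δ i j ≡ λ' * A i j + k * δ i j + μ) where

  T : ℕ → ℕ
  T ℓ = trace (power A ℓ)

  column-sum-power : ∀ ℓ j → ∑[ i < n ] power A ℓ i j ≡ k ^ ℓ
  column-sum-power zero    j = trans (sum-cong-≗ {n} (λ i → sym (*-identityʳ (δ i j)))) (∑-δˡ (λ _ → 1) j)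
  column-sum-power (suc ℓ) j = begin
    ∑[ i < n ] ∑[ v < n ] (A i v * power A ℓ v j)   ≡⟨ ∑-comm (λ i v → A i v * power A ℓ v j) ⟩
    ∑[ v < n ] ∑[ i < n ] (A i v * power A ℓ v j)
      ≡⟨ sum-cong-≗ {n} (λ v → *-distribʳ-sum (power A ℓ v j) (λ i → A i v)) ⟨
    ∑[ v < n ] (∑[ i < n ] A i v * power A ℓ v j)
      ≡⟨ sum-cong-≗ {n} (λ v → cong (_* power A ℓ v j) (column-sum v)) ⟩
    ∑[ v < n ] (k * power A ℓ v j)                  ≡⟨ *-distribˡ-sum k (λ v → power A ℓ v j) ⟨
    k * ∑[ v < n ] power A ℓ v j                    ≡⟨ cong (k *_) (column-sum-power ℓ j) ⟩
    k ^ suc ℓ                                       ∎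
    where open ≡-Reasoning

  -- Multiplying the quadratic identity on the right by A^ℓ.
  power-recurrence : ∀ ℓ i j →
    power A (2 + ℓ) i j + μ * power A (1 + ℓ) i j + μ * power A ℓ i j ≡
    λ' * power A (1 + ℓ) i j + k * power A ℓ i j + μ * k ^ ℓ
  power-recurrence ℓ i j = begin
    power A (2 + ℓ) i j + μ * power A (1 + ℓ) i j + μ * power A ℓ i j
      ≡⟨ cong₂ (λ s t → s + μ * power A (1 + ℓ) i j + μ * t) (∙-assoc A A W i j) (sym (∑-δʳ (λ u → W u j) i)) ⟩
    ((A ∙ A) ∙ W) i j + μ * (A ∙ W) i j + μ * ∑[ u < n ] (δ i u * W u j)
      ≡⟨ ∑-linear (λ u → (A ∙ A) i u * W u j) (λ u → A i u * W u j) (λ u → δ i u * W u j) μ μ ⟨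
    ∑[ u < n ] ((A ∙ A) i u * W u j + μ * (A i u * W u j) + μ * (δ i u * W u j))
      ≡⟨ sum-cong-≗ {n} (λ u → scale (quadratic i u) (W u j)) ⟩
    ∑[ u < n ] (λ' * (A i u * W u j) + k * (δ i u * W u j) + μ * W u j)
      ≡⟨ ∑-linear (λ u → λ' * (A i u * W u j)) (λ u → δ i u * W u j) (λ u → W u j) k μ ⟩
    ∑[ u < n ] (λ' * (A i u * W u j)) + k * ∑[ u < n ] (δ i u * W u j) + μ * ∑[ u < n ] W u j
      ≡⟨ cong₂ (λ s t → s + k * t + μ * ∑[ u < n ] W u j)
               (*-distribˡ-sum λ' (λ u → A i u * W u j)) (sym (∑-δʳ (λ u → W u j) i)) ⟨
    λ' * (A ∙ W) i j + k * W i j + μ * ∑[ u < n ] W u j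
      ≡⟨ cong (λ s → λ' * (A ∙ W) i j + k * W i j + μ * s) (column-sum-power ℓ j) ⟩
    λ' * power A (1 + ℓ) i j + k * power A ℓ i j + μ * k ^ ℓ ∎
    where
    open ≡-Reasoning
    W : Matrix n
    W = power A ℓ
    scale : ∀ {x a d} → x + μ * a + μ * d ≡ λ' * a + k * d + μ → ∀ w →
            x * w + μ * (a * w) + μ * (d * w) ≡ λ' * (a * w) + k * (d * w) + μ * w
    scale {x} {a} {d} eq w = begin
      x * w + μ * (a * w) + μ * (d * w)    ≡⟨ factor-right x a d w μ ⟩
      (x + μ * a + μ * d) * w              ≡⟨ cong (_* w) eq ⟩
      (λ' * a + k * d + μ) * w             ≡⟨ expand-right λ' a k d μ w ⟩
      λ' * (a * w) + k * (d * w) + μ * w   ∎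

  trace-recurrence : ∀ ℓ →
    T (2 + ℓ) + μ * T (1 + ℓ) + μ * T ℓ ≡ μ * n * k ^ ℓ + λ' * T (1 + ℓ) + k * T ℓ
  trace-recurrence ℓ = begin
    T (2 + ℓ) + μ * T (1 + ℓ) + μ * T ℓ
      ≡⟨ ∑-linear (λ i → power A (2 + ℓ) i i) (λ i → power A (1 + ℓ) i i) (λ i → power A ℓ i i) μ μ ⟨
    ∑[ i < n ] (power A (2 + ℓ) i i + μ * power A (1 + ℓ) i i + μ * power A ℓ i i)
      ≡⟨ sum-cong-≗ {n} (λ i → power-recurrence ℓ i i) ⟩
    ∑[ i < n ] (λ' * power A (1 + ℓ) i i + k * power A ℓ i i + μ * k ^ ℓ)
      ≡⟨ ∑-linear (λ i → λ' * power A (1 + ℓ) i i) (λ i → power A ℓ i i) (λ _ → k ^ ℓ) k μ ⟩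
    ∑[ i < n ] (λ' * power A (1 + ℓ) i i) + k * T ℓ + μ * ∑[ i < n ] (k ^ ℓ)
      ≡⟨ cong₂ (λ s t → s + k * T ℓ + μ * t)
               (*-distribˡ-sum λ' (λ i → power A (1 + ℓ) i i)) (sym (∑-const n (k ^ ℓ))) ⟨
    λ' * T (1 + ℓ) + k * T ℓ + μ * (n * k ^ ℓ)
      ≡⟨ bring-to-front (λ' * T (1 + ℓ)) (k * T ℓ) μ n (k ^ ℓ) ⟩
    μ * n * k ^ ℓ + λ' * T (1 + ℓ) + k * T ℓ ∎
    where open ≡-Reasoning

open import Data.Integer.Base as ℤ using (ℤ; +_)
open import Data.Integer.Properties using (pos-+; pos-*)
import Data.Integer.Tactic.RingSolver as ℤSolver

c-unique : ∀ {N K L M : ℤ} (s : ℕ → ℤ) → N ≡ s 0 → + 0 ≡ s 1 →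
           (∀ ℓ → s (2 + ℓ) ≡ M ℤ.* N ℤ.* K ℤ.^ ℓ ℤ.+ (L ℤ.- M) ℤ.* s (1 + ℓ) ℤ.+ (K ℤ.- M) ℤ.* s ℓ) →
           ∀ ℓ → c N K L M ℓ ≡ s ℓ
c-unique {N} {K} {L} {M} s s₀ s₁ step ℓ = proj₁ (consecutive ℓ)
  where
  consecutive : ∀ ℓ → c N K L M ℓ ≡ s ℓ × c N K L M (1 + ℓ) ≡ s (1 + ℓ)
  consecutive zero    = s₀ , s₁
  consecutive (suc ℓ) with consecutive ℓ
  ... | cℓ≡sℓ , cℓ₊₁≡sℓ₊₁ = cℓ₊₁≡sℓ₊₁ , trans
    (cong₂ (λ x y → M ℤ.* N ℤ.* K ℤ.^ ℓ ℤ.+ (L ℤ.- M) ℤ.* x ℤ.+ (K ℤ.- M) ℤ.* y) cℓ₊₁≡sℓ₊₁ cℓ≡sℓ)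
    (sym (step ℓ))

pos-^ : ∀ k ℓ → + (k ^ ℓ) ≡ (+ k) ℤ.^ ℓ
pos-^ k zero    = refl
pos-^ k (suc ℓ) = trans (pos-* k (k ^ ℓ)) (cong (+ k ℤ.*_) (pos-^ k ℓ))

pos-monomial : ∀ m n k ℓ → + (m * n * k ^ ℓ) ≡ + m ℤ.* + n ℤ.* (+ k) ℤ.^ ℓ
pos-monomial m n k ℓ = trans (pos-* (m * n) (k ^ ℓ)) (cong₂ ℤ._*_ (pos-* m n) (pos-^ k ℓ))

pos-affine : ∀ x b y c z → + (x + b * y + c * z) ≡ + x ℤ.+ + b ℤ.* + y ℤ.+ + c ℤ.* + z
pos-affine x b y c z = trans (pos-+ (x + b * y) (c * z))
  (cong₂ ℤ._+_ (trans (pos-+ x (b * y)) (cong (ℤ._+_ (+ x)) (pos-* b y))) (pos-* c z))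

expand-differences : ∀ q l m y k z →
  q ℤ.+ (l ℤ.- m) ℤ.* y ℤ.+ (k ℤ.- m) ℤ.* z ≡ (q ℤ.+ l ℤ.* y ℤ.+ k ℤ.* z) ℤ.- m ℤ.* y ℤ.- m ℤ.* z
expand-differences = ℤSolver.solve-∀

cancel-terms : ∀ x m y z → (x ℤ.+ m ℤ.* y ℤ.+ m ℤ.* z) ℤ.- m ℤ.* y ℤ.- m ℤ.* z ≡ x
cancel-terms = ℤSolver.solve-∀

recurrence-ℤ : ∀ X Y Z Q l k m → X + m * Y + m * Z ≡ Q + l * Y + k * Z →
               + Q ℤ.+ (+ l ℤ.- + m) ℤ.* + Y ℤ.+ (+ k ℤ.- + m) ℤ.* + Z ≡ + X
recurrence-ℤ X Y Z Q l k m eq = begin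
  + Q ℤ.+ (+ l ℤ.- + m) ℤ.* + Y ℤ.+ (+ k ℤ.- + m) ℤ.* + Z
    ≡⟨ expand-differences (+ Q) (+ l) (+ m) (+ Y) (+ k) (+ Z) ⟩
  (+ Q ℤ.+ + l ℤ.* + Y ℤ.+ + k ℤ.* + Z) ℤ.- + m ℤ.* + Y ℤ.- + m ℤ.* + Z
    ≡⟨ cong (λ t → t ℤ.- + m ℤ.* + Y ℤ.- + m ℤ.* + Z)
            (trans (sym (pos-affine Q l Y k Z)) (trans (cong +_ (sym eq)) (pos-affine X m Y m Z))) ⟩
  (+ X ℤ.+ + m ℤ.* + Y ℤ.+ + m ℤ.* + Z) ℤ.- + m ℤ.* + Y ℤ.- + m ℤ.* + Z
    ≡⟨ cancel-terms (+ X) (+ m) (+ Y) (+ Z) ⟩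
  + X ∎
  where open ≡-Reasoning

length-filter : ∀ {X : Set} {m} (f : Fin m → X) (b : X → Bool) →
                length (filter (λ x → b x ≟ᵇ true) (tabulate f)) ≡ ∑[ i < m ] 𝟙 (b (f i))
length-filter {m = zero}  f b = refl
length-filter {m = suc m} f b with b (f zero)
... | true  = cong suc (length-filter (λ i → f (suc i)) b)
... | false = length-filter (λ i → f (suc i)) b

𝟙-square : ∀ b → 𝟙 b * 𝟙 b ≡ 𝟙 b
𝟙-square true  = refl
𝟙-square false = refl

same-vertex : ∀ k l m → k + m * 0 + m * 1 ≡ l * 0 + k * 1 + m
same-vertex = solve-∀

adjacent-vertices : ∀ k l m → l + m * 1 + m * 0 ≡ l * 1 + k * 0 + m
adjacent-vertices = solve-∀

nonadjacent-vertices : ∀ k l m → m + m * 0 + m * 0 ≡ l * 0 + k * 0 + m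
nonadjacent-vertices = solve-∀

module StronglyRegularGraph {n : ℕ} (G : Graph n) {k λ' μ : ℕ}
  (regular     : ∀ i → degree G i ≡ k)
  (adjacent    : ∀ i j → i ≢ j → Graph.adj G i j ≡ true  → common G i j ≡ λ')
  (nonadjacent : ∀ i j → i ≢ j → Graph.adj G i j ≡ false → common G i j ≡ μ) where

  A : Matrix n
  A i j = 𝟙 (Graph.adj G i j)

  loopless : ∀ i → A i i ≡ 0
  loopless i = cong 𝟙 (Graph.irrefl G i)

  symmetric : ∀ i j → A i j ≡ A j i
  symmetric i j = cong 𝟙 (Graph.sym G i j)

  row-sum : ∀ i → ∑[ v < n ] A i v ≡ k
  row-sum i = trans (sym (length-filter (λ v → v) (Graph.adj G i))) (regular i)

  column-sum : ∀ j → ∑[ i < n ] A i j ≡ k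
  column-sum j = trans (sum-cong-≗ {n} (λ i → symmetric i j)) (row-sum j)

  square : ∀ i j → (A ∙ A) i j ≡ common G i j
  square i j = trans (sum-cong-≗ {n} (λ v → trans (cong (A i v *_) (symmetric v j))
                                                (sym (𝟙-∧ (Graph.adj G i v) (Graph.adj G j v)))))
                     (sym (length-filter (λ v → v) (λ v → Graph.adj G i v ∧ Graph.adj G j v)))

  square-diagonal : ∀ i → (A ∙ A) i i ≡ k
  square-diagonal i = trans (sum-cong-≗ {n} (λ v → trans (cong (A i v *_) (symmetric v i)) (𝟙-square (Graph.adj G i v))))
                            (row-sum i)

  -- A² + μA + μI = λA + kI + μJ entrywise: (A²)ᵢⱼ is k if i = j, λ if i ~ j
  -- and μ otherwise.
  quadratic : ∀ i j → (A ∙ A) i j + μ * A i j + μ * δ i j ≡ λ' * A i j + k * δ i j + μ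
  quadratic i j with i ≟ᶠ j
  ... | yes refl rewrite square-diagonal i | loopless i = same-vertex k λ' μ
  ... | no i≢j with Graph.adj G i j in adj≡
  ...   | true  rewrite square i j | adjacent i j i≢j adj≡    = adjacent-vertices k λ' μ
  ...   | false rewrite square i j | nonadjacent i j i≢j adj≡ = nonadjacent-vertices k λ' μ

  open TraceRecurrence A k λ' μ column-sum quadratic public

  trace-recurrence-ℤ : ∀ ℓ →
    + T (2 + ℓ) ≡
    + μ ℤ.* + n ℤ.* (+ k) ℤ.^ ℓ ℤ.+ (+ λ' ℤ.- + μ) ℤ.* + T (1 + ℓ) ℤ.+ (+ k ℤ.- + μ) ℤ.* + T ℓ
  trace-recurrence-ℤ ℓ = trans
    (sym (recurrence-ℤ (T (2 + ℓ)) (T (1 + ℓ)) (T ℓ) (μ * n * k ^ ℓ) λ' k μ (trace-recurrence ℓ)))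
    (cong (λ q → q ℤ.+ (+ λ' ℤ.- + μ) ℤ.* + T (1 + ℓ) ℤ.+ (+ k ℤ.- + μ) ℤ.* + T ℓ) (pos-monomial μ n k ℓ))

  c-trace : ∀ ℓ → c (+ n) (+ k) (+ λ') (+ μ) ℓ ≡ + T ℓ
  c-trace = c-unique (λ ℓ → + T ℓ) (sym (cong +_ trace-δ)) (sym (cong +_ (trace-zero-diagonal A loopless)))
                     trace-recurrence-ℤ

open import Data.Integer.Divisibility using (_∣_)

theorem2 : (n k λ' μ : ℕ) → Σ (Graph n) (λ G → IsSRG G k λ' μ) →
    (p : ℕ) → Prime p → (+ p) ∣ c (+ n) (+ k) (+ λ') (+ μ) p
theorem2 n k λ' μ (G , _ , _ , regular , adjacent , nonadjacent) p p-prime =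
  subst ((+ p) ∣_) (sym (c-trace p)) (trace-power-prime A loopless p-prime)
  where open StronglyRegularGraph G regular adjacent nonadjacent
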